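{- Let $t$ be a PPC term, let $V,M$ be lists of lists of symbols, let $X_1,\dots,X_n$ be lists of symbols, and let $k\ge0$, $i\geq1$ and $n\ge k+i$. Assume $X_l\cap(fv(t)\cup fm(t))=\emptyset$ for all $l\in[k+1,k+i-1]$. Then: (1) $\mathcal T_{X_1++\cdots++X_n,\,M}(t)=(\uparrow^{\mathsf v}_k)^{i-1}\big(\mathcal T_{X_1++\cdots++X_k++X_{k+i}++\cdots++X_n,\,M}(t)\big)$; (2) $\mathcal T_{V,\,X_1++\cdots++X_n}(t)=(\uparrow^{\mathsf m}_k)^{i-1}\big(\mathcal T_{V,\,X_1++\cdots++X_k++X_{k+i}++\cdots++X_n}(t)\big)$. Here both sides are assumed defined, i.e. the free symbols of $t$ occur in the relevant lists.
   Context: **PPC terms.** PPC terms over a countably infinite set of symbols: $t::=x\mid\hat x\mid t\,t\mid\lambda_\theta p.s$, where $\theta$ is a list of symbols binding the matchables $\hat x$ ($x\in\theta$) in $p$ and the variables $x$ in $s$. Free variables and matchables: $fv(x)=\{x\}$, $fm(\hat x)=\{x\}$ (empty otherwise); both are unions on applications; $fv(\lambda_\theta p.s)=fv(p)\cup(fv(s)\setminus\theta)$ and $fm(\lambda_\theta p.s)=(fm(p)\setminus\theta)\cup fm(s)$. **PPC_dB terms.** PPC_dB terms: $t::=\mathsf v_{i,j}\mid\mathsf m_{i,j}\mid t\,t\mid\lambda_np.s$, with $i,j\ge1$ and $n\in\mathbb N$. - $\uparrow^{\mathsf v}_k\mathsf v_{i,j}=\mathsf v_{i+1,j}$ if $i>k$,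 else unchanged; matchables unchanged; homomorphic on applications; $\uparrow^{\mathsf v}_k(\lambda_np.s)=\lambda_n\uparrow^{\mathsf v}_kp.\uparrow^{\mathsf v}_{k+1}s$. - $\uparrow^{\mathsf m}_k$ is symmetric on matchable indices, with $\uparrow^{\mathsf m}_k(\lambda_np.s)=\lambda_n\uparrow^{\mathsf m}_{k+1}p.\uparrow^{\mathsf m}_ks$. - $(f)^{m}$ denotes $m$-fold iteration. **Translation.** Lists of lists: $V_i$ is the $i$-th list, $V_{ij}$ its $j$-th element, and $++$ is concatenation (of lists of lists). For a list $\theta$ of symbols, $\theta++V$ means $[\theta]++V$. $\mathcal T_{V,M}$ (defined when $fv(t)\subseteq\bigcup V$ and $fm(t)\subseteq\bigcup M$): - $\mathcal T_{V,M}(x)=\mathsf v_{i,j}$ with $i=\min\{i'\mid x\in V_{i'}\}$ and $j=\min\{j'\mid x=V_{ij'}\}$; - $\mathcal T_{V,M}(\hat x)=\mathsf m_{i,j}$, likewise using $M$; - homomorphic on applications; - $\mathcal T_{V,M}(\lambda_\theta p.s)=\lambda_{|\theta|}\mathcal T_{V,\theta++M}(p).\mathcal T_{\theta++V,M}(s)$. -}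

module Defs where

open import Data.Nat using (ℕ; zero; suc; _+_; _<ᵇ_)
open import Data.Nat.Properties using (_≟_)
open import Data.Bool using (if_then_else_)
open import Data.List using (List; []; _∷_; _++_; filter; concat)
open import Data.List.Membership.DecPropositional _≟_ using (_∈?_)
open import Data.Maybe using (Maybe; just; nothing; _>>=_)
open import Data.Product using (_×_; _,_)
open import Relation.Nullary using (¬?)

Symbol : Set
Symbol = ℕ

-- PPC terms  t ::= x | x̂ | t t | λ_θ p . s
data Term : Set where
  var : Symbol → Term
  mat : Symbol → Term
  app : Term → Term → Term
  lam : List Symbol → Term → Term → Term

_∖_ : List Symbol → List Symbol → List Symbol
xs ∖ θ = filter (λ y → ¬? (y ∈? θ)) xs

fv : Term → List Symbol
fv (var x) = x ∷ []
fv (mat x) = []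
fv (app t u) = fv t ++ fv u
fv (lam θ p s) = fv p ++ (fv s ∖ θ)

fm : Term → List Symbol
fm (var x) = []
fm (mat x) = x ∷ []
fm (app t u) = fm t ++ fm u
fm (lam θ p s) = (fm p ∖ θ) ++ fm s

-- PPC_dB terms; indices are 1-based (the translation only produces i, j ≥ 1)
data DB : Set where
  v   : ℕ → ℕ → DB
  m   : ℕ → ℕ → DB
  app : DB → DB → DB
  lam : ℕ → DB → DB → DB

↑v : ℕ → DB → DB
↑v k (v i j) = if k <ᵇ i then v (suc i) j else v i j
↑v k (m i j) = m i j
↑v k (app t u) = app (↑v k t) (↑v k u)
↑v k (lam n p s) = lam n (↑v k p) (↑v (suc k) s)

↑m : ℕ → DB → DB
↑m k (v i j) = v i j
↑m k (m i j) = if k <ᵇ i then m (suc i) j else m i j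
↑m k (app t u) = app (↑m k t) (↑m k u)
↑m k (lam n p s) = lam n (↑m (suc k) p) (↑m k s)

iter : {A : Set} → ℕ → (A → A) → A → A
iter zero f a = a
iter (suc n) f a = f (iter n f a)

-- 1-based position of the first occurrence of x in a list
pos : Symbol → List Symbol → Maybe ℕ
pos x [] = nothing
pos x (y ∷ ys) with x ≟ y
... | Relation.Nullary.yes _ = just 1
... | Relation.Nullary.no _ = Data.Maybe.map suc (pos x ys)

locate : Symbol → List (List Symbol) → Maybe (ℕ × ℕ)
locate x [] = nothing
locate x (θ ∷ V) with pos x θ
... | just j = just (1 , j)
... | nothing = Data.Maybe.map (λ { (i , j) → (suc i , j) }) (locate x V)

-- the (partial) translation T_{V,M}; nothing = undefined
T : List (List Symbol) → List (List Symbol) → Term → Maybe DB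
T V M (var x) = Data.Maybe.map (λ { (i , j) → v i j }) (locate x V)
T V M (mat x) = Data.Maybe.map (λ { (i , j) → m i j }) (locate x M)
T V M (app t u) = T V M t >>= λ a → T V M u >>= λ b → just (app a b)
T V M (lam θ p s) =
  T V (θ ∷ M) p >>= λ a → T (θ ∷ V) M s >>= λ b → just (lam (Data.List.length θ) a b)

module Submission where

-- The translation T reads off de Bruijn indices via `locate`,
-- so everything reduces to one fact about locating a single symbol x:
-- if x occurs in none of the n rows V_{k+1}, …, V_{k+n}, then its position
-- (i , j) in V is obtained from its position in V with those rows excised by
-- shifting i exactly as n applications of ↑_k shift a variable index
-- (`relocates-fresh`).  Moreover, this relation survives pushing a new row θ
-- in front of V while raising the cutoff k to k+1, as long as x ∉ θ
-- (`relocates-cons`) — exactly what happens when T goes under a binder.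
--
-- An induction on t then proves that T commutes with
-- excision provided every free variable (resp. matchable) of t relocates
-- (`T-excise-vars`, `T-excise-matchables`).  The theorem is the case
-- n = i - 1, where the freshness hypothesis discharges the premise of
-- `relocates-fresh`.

open import Defs
open import Data.Nat using (ℕ; zero; suc; _+_; _∸_; _≤_; _<ᵇ_; s≤s; z≤n)
open import Data.Nat.Properties using (_≟_; +-suc; +-identityʳ)
open import Data.Bool using (true; false; if_then_else_)
open import Data.Bool.Properties using (if-float)
open import Data.Empty using (⊥-elim)
open import Data.List using (List; []; _∷_; length; take; drop; concat; _++_)
open import Data.List.Relation.Unary.All as All using (All; _∷_)
open import Data.List.Relation.Unary.Any using (here; there)
open import Data.List.Membership.Propositional using (_∈_; _∉_)
open import Data.List.Membership.Propositional.Properties using (∈-filter⁺; ∈-++⁺ˡ; ∈-++⁺ʳ)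
open import Data.List.Relation.Binary.Subset.Propositional using (_⊆_)
open import Data.Maybe using (Maybe; just; nothing; map; _>>=_)
import Data.Maybe.Relation.Unary.All as Maybe
open import Data.Maybe.Properties using (map-id)
open import Data.Product using (_×_; _,_; proj₁; ∃-syntax)
open import Relation.Nullary using (yes; no)
open import Relation.Binary.PropositionalEquality
  using (_≡_; refl; sym; trans; cong; cong₂; module ≡-Reasoning)

-- The effect of ↑_k (↑v k or ↑m k) on the first index of a variable / matchable.
shift : ℕ → ℕ → ℕ
shift k a = if k <ᵇ a then suc a else a

shiftⁿ : ℕ → ℕ → ℕ → ℕ
shiftⁿ n k = iter n (shift k)

shiftPos : ℕ → ℕ → ℕ × ℕ → ℕ × ℕ
shiftPos n k (a , b) = (shiftⁿ n k a , b)

-- Row 1 lies below every cutoff k+1, so it is never shifted.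
shiftⁿ-one : ∀ n k → shiftⁿ n (suc k) 1 ≡ 1
shiftⁿ-one zero    k = refl
shiftⁿ-one (suc n) k rewrite shiftⁿ-one n k = refl

shiftⁿ-suc : ∀ n k a → shiftⁿ n (suc k) (suc a) ≡ suc (shiftⁿ n k a)
shiftⁿ-suc zero    k a = refl
shiftⁿ-suc (suc n) k a rewrite shiftⁿ-suc n k a with k <ᵇ shiftⁿ n k a
... | true  = refl
... | false = refl

shiftⁿ-zero : ∀ n a → shiftⁿ n 0 (suc a) ≡ suc (a + n)
shiftⁿ-zero zero    a = cong suc (sym (+-identityʳ a))
shiftⁿ-zero (suc n) a rewrite shiftⁿ-zero n a | +-suc a n = refl

pos-∉ : ∀ {x} Y → x ∉ Y → pos x Y ≡ nothing
pos-∉ []      x∉Y = refl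
pos-∉ {x} (y ∷ Y) x∉Y with x ≟ y
... | yes x≡y = ⊥-elim (x∉Y (here x≡y))
... | no  _   rewrite pos-∉ Y (λ x∈Y → x∉Y (there x∈Y)) = refl

pos-nothing-∉ : ∀ {x} Y → pos x Y ≡ nothing → x ∉ Y
pos-nothing-∉ {x} (y ∷ Y) e x∈yY with x ≟ y
pos-nothing-∉ (y ∷ Y) () _ | yes _
pos-nothing-∉ (y ∷ Y) e (here x≡y) | no x≢y = x≢y x≡y
pos-nothing-∉ {x} (y ∷ Y) e (there x∈Y) | no _ with pos x Y in eq
... | nothing = pos-nothing-∉ Y eq x∈Y
pos-nothing-∉ (y ∷ Y) () (there _) | no _ | just _

locate-positive : ∀ x W → Maybe.All (λ p → ∃[ a ] proj₁ p ≡ suc a) (locate x W)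
locate-positive x []      = Maybe.nothing
locate-positive x (Y ∷ W) with pos x Y
... | just _  = Maybe.just (0 , refl)
... | nothing with locate x W
...   | nothing      = Maybe.nothing
...   | just (a , _) = Maybe.just (a , refl)

excise : ℕ → ℕ → List (List Symbol) → List (List Symbol)
excise k n V = take k V ++ drop (k + n) V

Relocates : List (List Symbol) → ℕ → ℕ → Symbol → Set
Relocates V k n x = locate x V ≡ map (shiftPos n k) (locate x (excise k n V))

-- Going under a binder: pushing a row θ ∌ x and raising the cutoff preserves relocation.
relocates-cons : ∀ {x} θ V k n → (x ∉ θ → Relocates V k n x) → Relocates (θ ∷ V) (suc k) n x
relocates-cons {x} θ V k n rel with pos x θ in eq
... | just _  rewrite shiftⁿ-one n k = refl
... | nothing rewrite rel (pos-nothing-∉ θ eq) with locate x (excise k n V)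
...   | nothing      = refl
...   | just (a , b) rewrite shiftⁿ-suc n k a = refl

relocates-fresh : ∀ {x} V k n → All (x ∉_) (take n (drop k V)) → Relocates V k n x
relocates-fresh     V       zero    zero    _            = sym (map-id _)
relocates-fresh     []      zero    (suc n) _            = refl
relocates-fresh {x} (Y ∷ V) zero    (suc n) (x∉Y ∷ rest) with pos x Y | pos-∉ Y x∉Y
... | nothing | refl rewrite relocates-fresh V zero n rest
  with locate x (drop n V) | locate-positive x (drop n V)
...   | nothing             | _                    = refl
...   | just (.(suc a) , b) | Maybe.just (a , refl) rewrite shiftⁿ-zero n a = refl
relocates-fresh     []      (suc k) n       _            = refl
relocates-fresh     (Y ∷ V) (suc k) n       fresh        =
  relocates-cons Y V k n (λ _ → relocates-fresh V k n fresh)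

iter-fixed : ∀ {A : Set} (f : A → A) {a} → f a ≡ a → ∀ n → iter n f a ≡ a
iter-fixed f fa≡a zero    = refl
iter-fixed f fa≡a (suc n) = trans (cong f (iter-fixed f fa≡a n)) fa≡a

iter-natural : ∀ {A B : Set} (f : A → A) (g : B → B) (c : B → A) →
  (∀ b → f (c b) ≡ c (g b)) → ∀ n b → iter n f (c b) ≡ c (iter n g b)
iter-natural f g c fc≡cg zero    b = refl
iter-natural f g c fc≡cg (suc n) b = trans (cong f (iter-natural f g c fc≡cg n b)) (fc≡cg _)

iter-natural₂ : ∀ {A B C : Set} (f : A → A) (g : B → B) (h : C → C) (c : B → C → A) →
  (∀ b d → f (c b d) ≡ c (g b) (h d)) → ∀ n b d → iter n f (c b d) ≡ c (iter n g b) (iter n h d)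
iter-natural₂ f g h c fc≡cgh zero    b d = refl
iter-natural₂ f g h c fc≡cgh (suc n) b d =
  trans (cong f (iter-natural₂ f g h c fc≡cgh n b d)) (fc≡cgh _ _)

iter-↑v-v : ∀ n k a b → iter n (↑v k) (v a b) ≡ v (shiftⁿ n k a) b
iter-↑v-v n k a b =
  iter-natural (↑v k) (shift k) (λ i → v i b) (λ i → sym (if-float (λ i → v i b) (k <ᵇ i))) n a

iter-↑m-m : ∀ n k a b → iter n (↑m k) (m a b) ≡ m (shiftⁿ n k a) b
iter-↑m-m n k a b =
  iter-natural (↑m k) (shift k) (λ i → m i b) (λ i → sym (if-float (λ i → m i b) (k <ᵇ i))) n a

lift₂ : (DB → DB → DB) → Maybe DB → Maybe DB → Maybe DB
lift₂ c A B = A >>= λ a → B >>= λ b → just (c a b)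

map-lift₂ : ∀ (F G H : DB → DB) (c : DB → DB → DB) → (∀ a b → F (c a b) ≡ c (G a) (H b)) →
  ∀ A B → lift₂ c (map G A) (map H B) ≡ map F (lift₂ c A B)
map-lift₂ F G H c Fc≡cGH nothing  B        = refl
map-lift₂ F G H c Fc≡cGH (just a) nothing  = refl
map-lift₂ F G H c Fc≡cGH (just a) (just b) = cong just (sym (Fc≡cGH a b))

T-excise-vars : ∀ t V M k n → (∀ x → x ∈ fv t → Relocates V k n x) →
  T V M t ≡ map (iter n (↑v k)) (T (excise k n V) M t)
T-excise-vars (var x) V M k n rel rewrite rel x (here refl) with locate x (excise k n V)
... | nothing      = refl
... | just (a , b) = cong just (sym (iter-↑v-v n k a b))
T-excise-vars (mat x) V M k n rel with locate x M
... | nothing      = refl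
... | just (a , b) = cong just (sym (iter-fixed (↑v k) refl n))
T-excise-vars (app t u) V M k n rel = begin
  lift₂ app (T V M t) (T V M u)
    ≡⟨ cong₂ (lift₂ app) (T-excise-vars t V M k n (λ x x∈ → rel x (∈-++⁺ˡ x∈)))
                         (T-excise-vars u V M k n (λ x x∈ → rel x (∈-++⁺ʳ (fv t) x∈))) ⟩
  lift₂ app (map ↑ⁿ (T V′ M t)) (map ↑ⁿ (T V′ M u))
    ≡⟨ map-lift₂ ↑ⁿ ↑ⁿ ↑ⁿ app (iter-natural₂ (↑v k) (↑v k) (↑v k) app (λ _ _ → refl) n)
                 (T V′ M t) (T V′ M u) ⟩
  map ↑ⁿ (lift₂ app (T V′ M t) (T V′ M u)) ∎
  where open ≡-Reasoning
        V′ = excise k n V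
        ↑ⁿ = iter n (↑v k)
T-excise-vars (lam θ p s) V M k n rel = begin
  lift₂ (lam ∣θ∣) (T V (θ ∷ M) p) (T (θ ∷ V) M s)
    ≡⟨ cong₂ (lift₂ (lam ∣θ∣))
         (T-excise-vars p V (θ ∷ M) k n (λ x x∈ → rel x (∈-++⁺ˡ x∈)))
         (T-excise-vars s (θ ∷ V) M (suc k) n (λ x x∈ → relocates-cons θ V k n (λ x∉θ →
            rel x (∈-++⁺ʳ (fv p) (∈-filter⁺ _ x∈ x∉θ))))) ⟩
  lift₂ (lam ∣θ∣) (map (iter n (↑v k)) (T V′ (θ ∷ M) p)) (map (iter n (↑v (suc k))) (T (θ ∷ V′) M s))
    ≡⟨ map-lift₂ (iter n (↑v k)) (iter n (↑v k)) (iter n (↑v (suc k))) (lam ∣θ∣)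
         (iter-natural₂ (↑v k) (↑v k) (↑v (suc k)) (lam ∣θ∣) (λ _ _ → refl) n)
         (T V′ (θ ∷ M) p) (T (θ ∷ V′) M s) ⟩
  map (iter n (↑v k)) (lift₂ (lam ∣θ∣) (T V′ (θ ∷ M) p) (T (θ ∷ V′) M s)) ∎
  where open ≡-Reasoning
        V′ = excise k n V
        ∣θ∣ = length θ

T-excise-matchables : ∀ t V M k n → (∀ x → x ∈ fm t → Relocates M k n x) →
  T V M t ≡ map (iter n (↑m k)) (T V (excise k n M) t)
T-excise-matchables (mat x) V M k n rel rewrite rel x (here refl) with locate x (excise k n M)
... | nothing      = refl
... | just (a , b) = cong just (sym (iter-↑m-m n k a b))
T-excise-matchables (var x) V M k n rel with locate x V
... | nothing      = refl
... | just (a , b) = cong just (sym (iter-fixed (↑m k) refl n))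
T-excise-matchables (app t u) V M k n rel = begin
  lift₂ app (T V M t) (T V M u)
    ≡⟨ cong₂ (lift₂ app) (T-excise-matchables t V M k n (λ x x∈ → rel x (∈-++⁺ˡ x∈)))
                         (T-excise-matchables u V M k n (λ x x∈ → rel x (∈-++⁺ʳ (fm t) x∈))) ⟩
  lift₂ app (map ↑ⁿ (T V M′ t)) (map ↑ⁿ (T V M′ u))
    ≡⟨ map-lift₂ ↑ⁿ ↑ⁿ ↑ⁿ app (iter-natural₂ (↑m k) (↑m k) (↑m k) app (λ _ _ → refl) n)
                 (T V M′ t) (T V M′ u) ⟩
  map ↑ⁿ (lift₂ app (T V M′ t) (T V M′ u)) ∎
  where open ≡-Reasoning
        M′ = excise k n M
        ↑ⁿ = iter n (↑m k)
T-excise-matchables (lam θ p s) V M k n rel = begin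
  lift₂ (lam ∣θ∣) (T V (θ ∷ M) p) (T (θ ∷ V) M s)
    ≡⟨ cong₂ (lift₂ (lam ∣θ∣))
         (T-excise-matchables p V (θ ∷ M) (suc k) n (λ x x∈ → relocates-cons θ M k n (λ x∉θ →
            rel x (∈-++⁺ˡ (∈-filter⁺ _ x∈ x∉θ)))))
         (T-excise-matchables s (θ ∷ V) M k n (λ x x∈ → rel x (∈-++⁺ʳ (fm p ∖ θ) x∈))) ⟩
  lift₂ (lam ∣θ∣) (map (iter n (↑m (suc k))) (T V (θ ∷ M′) p)) (map (iter n (↑m k)) (T (θ ∷ V) M′ s))
    ≡⟨ map-lift₂ (iter n (↑m k)) (iter n (↑m (suc k))) (iter n (↑m k)) (lam ∣θ∣)
         (iter-natural₂ (↑m k) (↑m (suc k)) (↑m k) (lam ∣θ∣) (λ _ _ → refl) n)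
         (T V (θ ∷ M′) p) (T (θ ∷ V) M′ s) ⟩
  map (iter n (↑m k)) (lift₂ (lam ∣θ∣) (T V (θ ∷ M′) p) (T (θ ∷ V) M′ s)) ∎
  where open ≡-Reasoning
        M′ = excise k n M
        ∣θ∣ = length θ

-- Lemma 4.2.  With i = n + 1, the rows X_{k+1}, …, X_{k+n} are fresh for t,
-- so every free symbol of t relocates and the two excision lemmas apply.
lemma4p2 : (t : Term) (V M Xs : List (List Symbol)) (k i : ℕ) →
    1 ≤ i → k + i ≤ length Xs →
    All (λ X → ∀ x → x ∈ X → x ∉ fv t ++ fm t) (take (i ∸ 1) (drop k Xs)) →
    ((fv t ⊆ concat Xs → fm t ⊆ concat M →
       T Xs M t ≡ map (iter (i ∸ 1) (↑v k)) (T (take k Xs ++ drop (k + i ∸ 1) Xs) M t))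
    × (fv t ⊆ concat V → fm t ⊆ concat Xs →
       T V Xs t ≡ map (iter (i ∸ 1) (↑m k)) (T V (take k Xs ++ drop (k + i ∸ 1) Xs) t)))
lemma4p2 t V M Xs k (suc n) (s≤s z≤n) _ fresh rewrite +-suc k n =
    (λ _ _ → T-excise-vars t Xs M k n (λ x x∈fv → relocates (∈-++⁺ˡ x∈fv)))
  , (λ _ _ → T-excise-matchables t V Xs k n (λ x x∈fm → relocates (∈-++⁺ʳ (fv t) x∈fm)))
  where
    relocates : ∀ {x} → x ∈ fv t ++ fm t → Relocates Xs k n x
    relocates x∈t = relocates-fresh Xs k n (All.map (λ X-fresh x∈X → X-fresh _ x∈X x∈t) fresh)
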